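{- Let $A$ be the adjacency matrix of a Paley type strongly regular graph on $n$ vertices, and let $A'=J-I-A$. Then the incidence structure $(\mathcal{V}_A,\mathcal{B}_A\cup\mathcal{B}_{A'})$ is a $2$-$(n,\frac{n-1}{2},\frac{n-3}{2})$ design and a $3$-$(n,\frac{n-1}{2},\frac{n-9}{4})$ adesign.
   Context: $J$ denotes the all-one matrix and $I$ the identity matrix. A strongly regular graph with parameters $(n,k,\lambda,\mu)$ is a graph on $n$ vertices, regular of degree $k$, in which any two adjacent vertices have exactly $\lambda$ common neighbours and any two distinct non-adjacent vertices have exactly $\mu$ common neighbours. It is of Paley type if, up to complementation, its parameters are $(n,\frac{n-1}{2},\frac{n-5}{4},\frac{n-1}{4})$. For a $0$-$1$ matrix $M$ with rows and columns indexed by the vertex set, $\mathcal{V}_M$ denotes the set indexing the columns of $M$ and $\mathcal{B}_M$ the collection of supports of the rows of $M$ (one block per row); $\mathcal{B}_A\cup\mathcal{B}_{A'}$ is the collection of all these $2n$ blocks. An incidence structure $(V,\mathcal{B})$ is a point set $V$ with a collection $\mathcal{B}$ of subsets (blocks), incidence by membership. A $t$-$(v,k,\lambda)$ design has $|V|=v$, all blocks of size $k$, and every $t$-subset of $V$ in exactly $\lambda$ blocks. A $t$-$(v,k,\lambda)$ adesign has $|V|=v$, all blocks of size $k$, every $t$-subset of $V$ in either $\lambda$ or $\lambda+1$ blocks for a positive integer $\lambda$, and is not a $t$-design. -}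

module Defs where

open import Data.Nat using (ℕ; suc; _≤_)
open import Data.Bool using (Bool; true; false; not; _∧_)
open import Data.Fin using (Fin; _≟_; splitAt)
open import Data.Fin.Subset using (Subset; ∣_∣)
open import Data.Fin.Subset.Properties using (_⊆?_)
open import Data.Vec using (tabulate)
open import Data.Sum using (_⊎_; inj₁; inj₂)
open import Data.Product using (_×_; ∃)
open import Relation.Nullary using (¬_; does)
open import Relation.Binary.PropositionalEquality using (_≡_; _≢_)

-- A 0-1 matrix with rows and columns indexed by Fin n (true = 1).
Matrix : ℕ → Set
Matrix n = Fin n → Fin n → Bool

IsAdjacency : {n : ℕ} → Matrix n → Set
IsAdjacency {n} A = (∀ i j → A i j ≡ A j i) × (∀ i → A i i ≡ false)

-- Support of row i of M (the block B_M contributed by row i).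
row : {n : ℕ} → Matrix n → Fin n → Subset n
row M i = tabulate (M i)

common : {n : ℕ} → Matrix n → Fin n → Fin n → ℕ
common A i j = ∣ tabulate (λ x → A i x ∧ A j x) ∣

IsSRG : {n : ℕ} → Matrix n → ℕ → ℕ → ℕ → Set
IsSRG {n} A k l m =
  IsAdjacency A
  × (∀ i → ∣ row A i ∣ ≡ k)
  × (∀ i j → i ≢ j → A i j ≡ true → common A i j ≡ l)
  × (∀ i j → i ≢ j → A i j ≡ false → common A i j ≡ m)

compl : {n : ℕ} → Matrix n → Matrix n
compl A i j = not (A i j) ∧ not (does (i ≟ j))

-- An incidence structure with point set Fin v and b blocks (a family, so
-- repeated blocks are counted with multiplicity).
Blocks : ℕ → ℕ → Set
Blocks v b = Fin b → Subset v

countBlocks : {v b : ℕ} → Blocks v b → Subset v → ℕ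
countBlocks B S = ∣ tabulate (λ i → does (S ⊆? B i)) ∣

IsDesign : {v b : ℕ} → ℕ → ℕ → ℕ → Blocks v b → Set
IsDesign {v} t k l B =
  (∀ i → ∣ B i ∣ ≡ k) × (∀ (S : Subset v) → ∣ S ∣ ≡ t → countBlocks B S ≡ l)

IsADesign : {v b : ℕ} → ℕ → ℕ → ℕ → Blocks v b → Set
IsADesign {v} t k l B =
  (∀ i → ∣ B i ∣ ≡ k)
  × 1 ≤ l
  × (∀ (S : Subset v) → ∣ S ∣ ≡ t → (countBlocks B S ≡ l ⊎ countBlocks B S ≡ suc l))
  × ¬ (∃ λ l' → IsDesign t k l' B)

blocksAA' : {n : ℕ} → Matrix n → Blocks n (n Data.Nat.+ n)
blocksAA' {n} A x with splitAt n x
... | inj₁ i = row A i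
... | inj₂ i = row (compl A) i

-- Row i of A contains a point set S when i is adjacent to every point of S, and row i of A' = J - I - A
-- when i lies outside S and is adjacent to none of its points; the vertices of S adjacent to none of S
-- are the isolated vertices of the graph induced on S. Inclusion-exclusion over the vertices therefore
-- expresses the number of blocks through a pair or a triple by degrees, common-neighbour counts and the
-- induced graph. With the Paley parameters (degree 2m, λ + [x ~ y] = m for x ≠ y, n = 4m + 1) every pair
-- lies in 2m - 1 blocks, while a triple lies in m - 2 blocks if it spans a triangle or a coclique and in
-- m - 1 blocks otherwise. Both kinds of triple occur (a triangle exists since λ = m - 1 ≥ 1), so the
-- 3-counts are not constant. Since compl (compl A) = A, the family B_A ∪ B_A' is the same whichever of
-- A and A' is the strongly regular graph.
module Submission where

open import Defs
open import Data.Bool using (Bool; true; false; not; _∧_; _∨_; T)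
open import Data.Bool.Properties using (∧-identityʳ; ∧-zeroʳ; not-involutive; T-≡)
open import Data.Fin using (Fin; zero; suc; _≟_; splitAt; _↑ˡ_; _↑ʳ_)
open import Data.Fin.Properties using (splitAt-↑ˡ; splitAt-↑ʳ)
open import Data.Fin.Subset using (Subset; ∣_∣; _∈_; _⊆_)
open import Data.Fin.Subset.Properties using (_⊆?_)
open import Data.Bool.ListAction using (and; all; any)
open import Data.List using (List; []; _∷_; length; map)
open import Data.List.Properties using (map-cong)
open import Data.List.Membership.Propositional using () renaming (_∈_ to _∈ₗ_)
open import Data.List.Relation.Unary.All as All using (All; []; _∷_)
open import Data.List.Relation.Unary.All.Properties using (all⁺; all⁻; ¬Any⇒All¬)
open import Data.List.Relation.Unary.Any as Any using ()
open import Data.List.Relation.Unary.Any.Properties using (any⁺; any⁻)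
open import Data.List.Relation.Unary.Unique.Propositional using (Unique; []; _∷_)
open import Data.Nat using (ℕ; zero; suc; _+_; _*_; _∸_; _≤_; _<_; z≤n; s≤s; s≤s⁻¹)
open import Data.Nat.ListAction using (sum)
open import Data.Nat.Tactic.RingSolver using (solve-∀)
open import Data.Nat.Properties
  using ( +-0-commutativeMonoid; +-assoc; +-comm; +-suc; +-identityʳ; +-cancelˡ-≡; +-cancelʳ-≡
        ; m+n∸n≡m; m∸n+n≡m; ≤-trans; m≤m+n; n≤1+n; ∸-monoˡ-≤; 1+n≢n; suc-injective
        ; m+n≡0⇒m≡0; m+n≡0⇒n≡0 )
open import Data.Product using (_×_; _,_; ∃; ∃₂; proj₁; proj₂)
open import Data.Sum using (_⊎_; inj₁; inj₂; [_,_]′)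
open import Data.Vec using (tabulate; lookup)
open import Data.Vec.Properties using (lookup∘tabulate; tabulate∘lookup; []=⇒lookup; lookup⇒[]=)
open import Function using (_∘_; _⇔_; mk⇔; Equivalence)
open import Relation.Nullary using (¬_; does; yes; no)
open import Relation.Nullary.Decidable using (T?; does-⇔; dec-true; dec-false)
open import Relation.Binary.PropositionalEquality

open import Algebra.Properties.CommutativeMonoid.Sum +-0-commutativeMonoid
  using (∑-distrib-+; sum-cong-≗) renaming (sum to ∑)
open Equivalence using (to; from)

⟦_⟧ : Bool → ℕ
⟦ true ⟧ = 1
⟦ false ⟧ = 0

count : {n : ℕ} → (Fin n → Bool) → ℕ
count f = ∑ (λ i → ⟦ f i ⟧)

∣tabulate∣≡count : {n : ℕ} (f : Fin n → Bool) → ∣ tabulate f ∣ ≡ count f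
∣tabulate∣≡count {zero} f = refl
∣tabulate∣≡count {suc n} f with f zero
... | true = cong suc (∣tabulate∣≡count (f ∘ suc))
... | false = ∣tabulate∣≡count (f ∘ suc)

count-cong : {n : ℕ} {f g : Fin n → Bool} → (∀ i → f i ≡ g i) → count f ≡ count g
count-cong f≗g = sum-cong-≗ (cong ⟦_⟧ ∘ f≗g)

count-true : {n : ℕ} → count {n} (λ _ → true) ≡ n
count-true {zero} = refl
count-true {suc n} = cong suc (count-true {n})

count-false : {n : ℕ} → count {n} (λ _ → false) ≡ 0
count-false {zero} = refl
count-false {suc n} = count-false {n}

count-split : {n : ℕ} (f g : Fin n → Bool) →
  count f ≡ count (λ i → f i ∧ g i) + count (λ i → f i ∧ not (g i))
count-split f g = trans (sum-cong-≗ (λ i → ⟦⟧-split (f i) (g i)))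
                        (∑-distrib-+ (λ i → ⟦ f i ∧ g i ⟧) (λ i → ⟦ f i ∧ not (g i) ⟧))
  where
  ⟦⟧-split : ∀ a b → ⟦ a ⟧ ≡ ⟦ a ∧ b ⟧ + ⟦ a ∧ not b ⟧
  ⟦⟧-split false _ = refl
  ⟦⟧-split true true = refl
  ⟦⟧-split true false = refl

count-∧-≟ : {n : ℕ} (f : Fin n → Bool) (x : Fin n) → count (λ i → f i ∧ does (i ≟ x)) ≡ ⟦ f x ⟧
count-∧-≟ {suc n} f zero = begin
  ⟦ f zero ∧ true ⟧ + count (λ i → f (suc i) ∧ false)
    ≡⟨ cong₂ _+_ (cong ⟦_⟧ (∧-identityʳ (f zero))) (count-cong (∧-zeroʳ ∘ f ∘ suc)) ⟩
  ⟦ f zero ⟧ + count {n} (λ _ → false)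
    ≡⟨ cong (⟦ f zero ⟧ +_) (count-false {n}) ⟩
  ⟦ f zero ⟧ + 0
    ≡⟨ +-identityʳ _ ⟩
  ⟦ f zero ⟧ ∎
  where open ≡-Reasoning
count-∧-≟ {suc n} f (suc x) =
  trans (cong (λ b → ⟦ b ⟧ + count (λ i → f (suc i) ∧ does (i ≟ x))) (∧-zeroʳ (f zero)))
        (count-∧-≟ (f ∘ suc) x)

count-peel : {n : ℕ} (f : Fin n → Bool) (x : Fin n) →
  count f ≡ ⟦ f x ⟧ + count (λ i → f i ∧ not (does (i ≟ x)))
count-peel f x = trans (count-split f (λ i → does (i ≟ x)))
                       (cong (_+ count (λ i → f i ∧ not (does (i ≟ x)))) (count-∧-≟ f x))

count-∖ : {n : ℕ} (f : Fin n → Bool) (x : Fin n) → f x ≡ false →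
  count (λ i → f i ∧ not (does (i ≟ x))) ≡ count f
count-∖ f x fx≡false =
  sym (trans (count-peel f x) (cong (λ b → ⟦ b ⟧ + count (λ i → f i ∧ not (does (i ≟ x)))) fx≡false))

count≡0 : {n : ℕ} (f : Fin n → Bool) → count f ≡ 0 → ∀ i → f i ≡ false
count≡0 {suc n} f c zero = ⟦⟧≡0 (m+n≡0⇒m≡0 ⟦ f zero ⟧ c)
  where
  ⟦⟧≡0 : ∀ {b} → ⟦ b ⟧ ≡ 0 → b ≡ false
  ⟦⟧≡0 {false} _ = refl
count≡0 {suc n} f c (suc i) = count≡0 (f ∘ suc) (m+n≡0⇒n≡0 ⟦ f zero ⟧ c) i

count>0 : {n : ℕ} (f : Fin n → Bool) → 0 < count f → ∃ λ i → f i ≡ true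
count>0 {suc n} f pos with f zero in f0
... | true = zero , f0
... | false with count>0 (f ∘ suc) pos
...   | i , fi = suc i , fi

count-↑ : (m k : ℕ) (f : Fin (m + k) → Bool) →
  count f ≡ count (λ i → f (i ↑ˡ k)) + count (λ j → f (m ↑ʳ j))
count-↑ zero k f = refl
count-↑ (suc m) k f =
  trans (cong (⟦ f zero ⟧ +_) (count-↑ m k (f ∘ suc))) (sym (+-assoc ⟦ f zero ⟧ _ _))

_∈ᵇ_ : {n : ℕ} → Fin n → List (Fin n) → Bool
v ∈ᵇ xs = any (λ x → does (v ≟ x)) xs

T-does-≟ : {n : ℕ} {v x : Fin n} → T (does (v ≟ x)) ⇔ v ≡ x
T-does-≟ {v = v} {x} with v ≟ x
... | yes v≡x = mk⇔ (λ _ → v≡x) _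
... | no v≢x = mk⇔ (λ ()) v≢x

T-∈ᵇ : {n : ℕ} {v : Fin n} (xs : List (Fin n)) → T (v ∈ᵇ xs) ⇔ v ∈ₗ xs
T-∈ᵇ xs = mk⇔ (Any.map (to T-does-≟) ∘ any⁻ _ xs) (any⁺ _ ∘ Any.map (from T-does-≟))

∉⇒∈ᵇ≡false : {n : ℕ} {v : Fin n} {xs : List (Fin n)} → All (v ≢_) xs → v ∈ᵇ xs ≡ false
∉⇒∈ᵇ≡false [] = refl
∉⇒∈ᵇ≡false {v = v} {x ∷ _} (v≢x ∷ v∉xs) = cong₂ _∨_ (dec-false (v ≟ x) v≢x) (∉⇒∈ᵇ≡false v∉xs)

∈ᵇ≡false⇒∉ : {n : ℕ} {v : Fin n} {xs : List (Fin n)} → v ∈ᵇ xs ≡ false → All (v ≢_) xs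
∈ᵇ≡false⇒∉ {xs = xs} v∉xs = ¬Any⇒All¬ xs (λ v∈xs → subst T v∉xs (from (T-∈ᵇ xs) v∈xs))

count-∧-∈ᵇ : {n : ℕ} (f : Fin n → Bool) {xs : List (Fin n)} → Unique xs →
  count (λ i → f i ∧ i ∈ᵇ xs) ≡ sum (map (⟦_⟧ ∘ f) xs)
count-∧-∈ᵇ {n} f [] = trans (count-cong (∧-zeroʳ ∘ f)) (count-false {n})
count-∧-∈ᵇ f {x ∷ xs} (x∉xs ∷ xs-unique) = begin
  count (λ i → f i ∧ (does (i ≟ x) ∨ i ∈ᵇ xs))
    ≡⟨ count-split (λ i → f i ∧ (does (i ≟ x) ∨ i ∈ᵇ xs)) (λ i → does (i ≟ x)) ⟩
  count (λ i → (f i ∧ (does (i ≟ x) ∨ i ∈ᵇ xs)) ∧ does (i ≟ x))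
    + count (λ i → (f i ∧ (does (i ≟ x) ∨ i ∈ᵇ xs)) ∧ not (does (i ≟ x)))
    ≡⟨ cong₂ _+_ (count-cong (λ i → ∨-∧-here (f i) (does (i ≟ x)) (i ∈ᵇ xs)))
                 (count-cong (λ i → ∨-∧-there (f i) (does (i ≟ x)) (i ∈ᵇ xs))) ⟩
  count (λ i → f i ∧ does (i ≟ x)) + count (λ i → (f i ∧ i ∈ᵇ xs) ∧ not (does (i ≟ x)))
    ≡⟨ cong₂ _+_ (count-∧-≟ f x)
                 (count-∖ (λ i → f i ∧ i ∈ᵇ xs) x (trans (cong (f x ∧_) (∉⇒∈ᵇ≡false x∉xs)) (∧-zeroʳ (f x)))) ⟩
  ⟦ f x ⟧ + count (λ i → f i ∧ i ∈ᵇ xs)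
    ≡⟨ cong (⟦ f x ⟧ +_) (count-∧-∈ᵇ f xs-unique) ⟩
  ⟦ f x ⟧ + sum (map (⟦_⟧ ∘ f) xs) ∎
  where
  open ≡-Reasoning
  ∨-∧-here : ∀ c a b → (c ∧ (a ∨ b)) ∧ a ≡ c ∧ a
  ∨-∧-here false a b = refl
  ∨-∧-here true true b = refl
  ∨-∧-here true false b = ∧-zeroʳ b
  ∨-∧-there : ∀ c a b → (c ∧ (a ∨ b)) ∧ not a ≡ (c ∧ b) ∧ not a
  ∨-∧-there false a b = refl
  ∨-∧-there true true b = sym (∧-zeroʳ b)
  ∨-∧-there true false b = refl

Enumerates : {n : ℕ} → List (Fin n) → (Fin n → Bool) → Set
Enumerates xs f = Unique xs × (∀ v → f v ≡ v ∈ᵇ xs)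

enumerate : {n : ℕ} (k : ℕ) (f : Fin n → Bool) → count f ≡ k →
  ∃ λ xs → length xs ≡ k × Enumerates xs f
enumerate zero f none = [] , refl , [] , count≡0 f none
enumerate (suc k) f count≡1+k with count>0 f (subst (0 <_) (sym count≡1+k) (s≤s z≤n))
... | x , fx with enumerate k (λ v → f v ∧ not (does (v ≟ x))) (suc-injective (trans (sym peeled) count≡1+k))
  where
  peeled : count f ≡ suc (count (λ v → f v ∧ not (does (v ≟ x))))
  peeled = trans (count-peel f x) (cong (λ b → ⟦ b ⟧ + count (λ v → f v ∧ not (does (v ≟ x)))) fx)
...   | xs , length≡k , xs-unique , rest≗xs =
  x ∷ xs , cong suc length≡k , ∈ᵇ≡false⇒∉ x∉xs ∷ xs-unique ,
  λ v → trans (split-at-x v) (cong (does (v ≟ x) ∨_) (rest≗xs v))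
  where
  x∉xs : x ∈ᵇ xs ≡ false
  x∉xs = trans (sym (rest≗xs x))
               (trans (cong (λ b → f x ∧ not b) (dec-true (x ≟ x) refl)) (∧-zeroʳ (f x)))
  split-at-x : ∀ v → f v ≡ does (v ≟ x) ∨ (f v ∧ not (does (v ≟ x)))
  split-at-x v with v ≟ x
  ... | yes refl = fx
  ... | no _ = sym (∧-identityʳ (f v))

∑-+-count : {n : ℕ} (a : Fin n → ℕ) (g : Fin n → Bool) → ∑ a + count g ≡ ∑ (λ i → a i + ⟦ g i ⟧)
∑-+-count a g = sym (∑-distrib-+ a (⟦_⟧ ∘ g))

inclusion-exclusion₂ : {n : ℕ} (f g : Fin n → Bool) →
  count (λ i → not (f i) ∧ not (g i)) + count f + count g ≡ n + count (λ i → f i ∧ g i)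
inclusion-exclusion₂ {n} f g = begin
  count (λ i → not (f i) ∧ not (g i)) + count f + count g
    ≡⟨ trans (cong (_+ count g) (∑-+-count _ f)) (∑-+-count _ g) ⟩
  ∑ (λ i → ⟦ not (f i) ∧ not (g i) ⟧ + ⟦ f i ⟧ + ⟦ g i ⟧)
    ≡⟨ sum-cong-≗ (λ i → pointwise (f i) (g i)) ⟩
  ∑ (λ i → ⟦ true ⟧ + ⟦ f i ∧ g i ⟧)
    ≡⟨ sym (∑-+-count (λ _ → 1) (λ i → f i ∧ g i)) ⟩
  count {n} (λ _ → true) + count (λ i → f i ∧ g i)
    ≡⟨ cong (_+ count (λ i → f i ∧ g i)) count-true ⟩
  n + count (λ i → f i ∧ g i) ∎
  where
  open ≡-Reasoning
  pointwise : ∀ a b → ⟦ not a ∧ not b ⟧ + ⟦ a ⟧ + ⟦ b ⟧ ≡ 1 + ⟦ a ∧ b ⟧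
  pointwise true true = refl
  pointwise true false = refl
  pointwise false true = refl
  pointwise false false = refl

inclusion-exclusion₃ : {n : ℕ} (f g h : Fin n → Bool) →
  count (λ i → f i ∧ g i ∧ h i) + count (λ i → not (f i) ∧ not (g i) ∧ not (h i))
    + count f + count g + count h
  ≡ n + count (λ i → f i ∧ g i) + count (λ i → f i ∧ h i) + count (λ i → g i ∧ h i)
inclusion-exclusion₃ {n} f g h = begin
  count (λ i → f i ∧ g i ∧ h i) + count (λ i → not (f i) ∧ not (g i) ∧ not (h i))
    + count f + count g + count h
    ≡⟨ trans (cong (λ t → t + count f + count g + count h)
                   (∑-+-count _ (λ i → not (f i) ∧ not (g i) ∧ not (h i))))
       (trans (cong (λ t → t + count g + count h) (∑-+-count _ f))
       (trans (cong (_+ count h) (∑-+-count _ g))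
              (∑-+-count _ h))) ⟩
  ∑ (λ i → ⟦ f i ∧ g i ∧ h i ⟧ + ⟦ not (f i) ∧ not (g i) ∧ not (h i) ⟧ + ⟦ f i ⟧ + ⟦ g i ⟧ + ⟦ h i ⟧)
    ≡⟨ sum-cong-≗ (λ i → pointwise (f i) (g i) (h i)) ⟩
  ∑ (λ i → ⟦ true ⟧ + ⟦ f i ∧ g i ⟧ + ⟦ f i ∧ h i ⟧ + ⟦ g i ∧ h i ⟧)
    ≡⟨ sym (trans (cong (λ t → t + count (λ i → f i ∧ h i) + count (λ i → g i ∧ h i))
                        (∑-+-count (λ _ → 1) (λ i → f i ∧ g i)))
           (trans (cong (_+ count (λ i → g i ∧ h i))
                        (∑-+-count (λ i → 1 + ⟦ f i ∧ g i ⟧) (λ i → f i ∧ h i)))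
                  (∑-+-count (λ i → 1 + ⟦ f i ∧ g i ⟧ + ⟦ f i ∧ h i ⟧) (λ i → g i ∧ h i)))) ⟩
  count {n} (λ _ → true) + count (λ i → f i ∧ g i) + count (λ i → f i ∧ h i) + count (λ i → g i ∧ h i)
    ≡⟨ cong (λ t → t + count (λ i → f i ∧ g i) + count (λ i → f i ∧ h i) + count (λ i → g i ∧ h i))
            count-true ⟩
  n + count (λ i → f i ∧ g i) + count (λ i → f i ∧ h i) + count (λ i → g i ∧ h i) ∎
  where
  open ≡-Reasoning
  pointwise : ∀ a b c → ⟦ a ∧ b ∧ c ⟧ + ⟦ not a ∧ not b ∧ not c ⟧ + ⟦ a ⟧ + ⟦ b ⟧ + ⟦ c ⟧
                        ≡ 1 + ⟦ a ∧ b ⟧ + ⟦ a ∧ c ⟧ + ⟦ b ∧ c ⟧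
  pointwise true true true = refl
  pointwise true true false = refl
  pointwise true false true = refl
  pointwise true false false = refl
  pointwise false true true = refl
  pointwise false true false = refl
  pointwise false false true = refl
  pointwise false false false = refl

∈⇔T-lookup : {n : ℕ} {p : Subset n} {v : Fin n} → v ∈ p ⇔ T (lookup p v)
∈⇔T-lookup {p = p} {v} = mk⇔ (λ v∈p → subst T (sym ([]=⇒lookup v∈p)) _) (lookup⇒[]= v p ∘ to T-≡)

∈-tabulate : {n : ℕ} {f : Fin n → Bool} {v : Fin n} → v ∈ tabulate f ⇔ T (f v)
∈-tabulate {f = f} {v} = mk⇔ (subst T (lookup∘tabulate f v) ∘ to ∈⇔T-lookup)
                             (from ∈⇔T-lookup ∘ subst T (sym (lookup∘tabulate f v)))

⊆?-tabulate : {n : ℕ} {S : Subset n} {xs : List (Fin n)} → (∀ v → lookup S v ≡ v ∈ᵇ xs) →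
  (f : Fin n → Bool) → does (S ⊆? tabulate f) ≡ all f xs
⊆?-tabulate {S = S} {xs} S≗xs f = does-⇔ (mk⇔ ⊆⇒all all⇒⊆) (S ⊆? tabulate f) (T? (all f xs))
  where
  ∈S⇔∈xs : ∀ {v} → v ∈ S ⇔ v ∈ₗ xs
  ∈S⇔∈xs {v} = mk⇔ (to (T-∈ᵇ xs) ∘ subst T (S≗xs v) ∘ to ∈⇔T-lookup)
                   (from ∈⇔T-lookup ∘ subst T (sym (S≗xs v)) ∘ from (T-∈ᵇ xs))
  ⊆⇒all : S ⊆ tabulate f → T (all f xs)
  ⊆⇒all S⊆f = all⁻ f (All.tabulate (λ x∈xs → to ∈-tabulate (S⊆f (from ∈S⇔∈xs x∈xs))))
  all⇒⊆ : T (all f xs) → S ⊆ tabulate f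
  all⇒⊆ t v∈S = from ∈-tabulate (All.lookup (all⁺ f xs t) (to ∈S⇔∈xs v∈S))

enumerate-subset : {n : ℕ} (k : ℕ) (S : Subset n) → ∣ S ∣ ≡ k →
  ∃ λ xs → length xs ≡ k × Enumerates xs (lookup S)
enumerate-subset k S ∣S∣≡k = enumerate k (lookup S) (trans (sym ∣S∣≡count) ∣S∣≡k)
  where
  ∣S∣≡count : ∣ S ∣ ≡ count (lookup S)
  ∣S∣≡count = trans (cong ∣_∣ (sym (tabulate∘lookup S))) (∣tabulate∣≡count (lookup S))

covers : {n : ℕ} → Matrix n → List (Fin n) → ℕ
covers M xs = count (λ i → all (M i) xs)

blocksAA'-↑ˡ : {n : ℕ} (A : Matrix n) (i : Fin n) → blocksAA' A (i ↑ˡ n) ≡ row A i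
blocksAA'-↑ˡ {n} A i rewrite splitAt-↑ˡ n i n = refl

blocksAA'-↑ʳ : {n : ℕ} (A : Matrix n) (i : Fin n) → blocksAA' A (n ↑ʳ i) ≡ row (compl A) i
blocksAA'-↑ʳ {n} A i rewrite splitAt-↑ʳ n n i = refl

countBlocks-blocksAA' : {n : ℕ} (A : Matrix n) (S : Subset n) (xs : List (Fin n)) →
  (∀ v → lookup S v ≡ v ∈ᵇ xs) → countBlocks (blocksAA' A) S ≡ covers A xs + covers (compl A) xs
countBlocks-blocksAA' {n} A S xs S≗xs = begin
  countBlocks (blocksAA' A) S
    ≡⟨ ∣tabulate∣≡count (λ b → does (S ⊆? blocksAA' A b)) ⟩
  count (λ b → does (S ⊆? blocksAA' A b))
    ≡⟨ count-↑ n n _ ⟩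
  count (λ i → does (S ⊆? blocksAA' A (i ↑ˡ n))) + count (λ i → does (S ⊆? blocksAA' A (n ↑ʳ i)))
    ≡⟨ cong₂ _+_ (count-cong (λ i → trans (cong (does ∘ (S ⊆?_)) (blocksAA'-↑ˡ A i))
                                          (⊆?-tabulate {S = S} {xs} S≗xs (A i))))
                 (count-cong (λ i → trans (cong (does ∘ (S ⊆?_)) (blocksAA'-↑ʳ A i))
                                          (⊆?-tabulate {S = S} {xs} S≗xs (compl A i)))) ⟩
  covers A xs + covers (compl A) xs ∎
  where open ≡-Reasoning

blocksAA'-size : {n k : ℕ} {A : Matrix n} → (∀ i → ∣ row A i ∣ ≡ k) → (∀ i → ∣ row (compl A) i ∣ ≡ k) →
  ∀ b → ∣ blocksAA' A b ∣ ≡ k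
blocksAA'-size {n} rowA rowA′ b with splitAt n b
... | inj₁ i = rowA i
... | inj₂ i = rowA′ i

row-size : {n k : ℕ} {M M′ : Matrix n} → (∀ i j → M i j ≡ M′ i j) → (∀ i → count (M′ i) ≡ k) →
  ∀ i → ∣ row M i ∣ ≡ k
row-size {M = M} M≗M′ size i = trans (∣tabulate∣≡count (M i)) (trans (count-cong (M≗M′ i)) (size i))

covers-cong : {n : ℕ} {M M′ : Matrix n} → (∀ i j → M i j ≡ M′ i j) → ∀ xs → covers M xs ≡ covers M′ xs
covers-cong M≗M′ xs = count-cong (λ i → cong and (map-cong (M≗M′ i) xs))

compl-involutive : {n : ℕ} {A : Matrix n} → (∀ i → A i i ≡ false) → ∀ i j → compl (compl A) i j ≡ A i j
compl-involutive {A = A} irreflexive i j with i ≟ j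
... | yes refl = trans (∧-zeroʳ _) (sym (irreflexive i))
... | no _ = trans (∧-identityʳ _) (trans (cong not (∧-identityʳ (not (A i j)))) (not-involutive (A i j)))

compl≡true : {n : ℕ} {G : Matrix n} {x w : Fin n} → compl G x w ≡ true → G x w ≡ false × x ≢ w
compl≡true {G = G} {x} {w} x≁w with G x w | x ≟ w
... | false | no x≢w = refl , x≢w

all-compl : {n : ℕ} (G : Matrix n) (i : Fin n) (xs : List (Fin n)) →
  all (compl G i) xs ≡ all (not ∘ G i) xs ∧ not (i ∈ᵇ xs)
all-compl G i [] = refl
all-compl G i (x ∷ xs) =
  trans (cong ((not (G i x) ∧ not (does (i ≟ x))) ∧_) (all-compl G i xs))
        (interchange (not (G i x)) (does (i ≟ x)) (all (not ∘ G i) xs) (i ∈ᵇ xs))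
  where
  interchange : ∀ a b c d → (a ∧ not b) ∧ (c ∧ not d) ≡ (a ∧ c) ∧ not (b ∨ d)
  interchange false b c d = refl
  interchange true true c d = sym (∧-zeroʳ c)
  interchange true false c d = refl

isolated : {n : ℕ} → Matrix n → List (Fin n) → ℕ
isolated G xs = count (λ i → all (not ∘ G i) xs ∧ i ∈ᵇ xs)

count-nonadjacent : {n : ℕ} (G : Matrix n) (xs : List (Fin n)) →
  count (λ i → all (not ∘ G i) xs) ≡ covers (compl G) xs + isolated G xs
count-nonadjacent G xs = begin
  count (λ i → all (not ∘ G i) xs)
    ≡⟨ count-split (λ i → all (not ∘ G i) xs) (_∈ᵇ xs) ⟩
  isolated G xs + count (λ i → all (not ∘ G i) xs ∧ not (i ∈ᵇ xs))
    ≡⟨ +-comm (isolated G xs) _ ⟩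
  count (λ i → all (not ∘ G i) xs ∧ not (i ∈ᵇ xs)) + isolated G xs
    ≡⟨ cong (_+ isolated G xs) (count-cong (λ i → sym (all-compl G i xs))) ⟩
  covers (compl G) xs + isolated G xs ∎
  where open ≡-Reasoning

homogeneous : Bool → Bool → Bool → Bool
homogeneous a b c = (a ∧ b ∧ c) ∨ (not a ∧ not b ∧ not c)

homogeneous-true : ∀ {a b c} → a ≡ true → b ≡ true → c ≡ true → homogeneous a b c ≡ true
homogeneous-true refl refl refl = refl

homogeneous-false : ∀ {a b c} → a ≡ true → b ≡ false → homogeneous a b c ≡ false
homogeneous-false refl refl = refl

∧≡true : ∀ {a b} → a ∧ b ≡ true → a ≡ true × b ≡ true
∧≡true {true} {true} _ = refl , refl

pair-arithmetic : ∀ {n b c b′ i a N dx dy} → b ≡ c → i + 2 * a ≡ 2 → N ≡ b′ + i → N + dx + dy ≡ n + c →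
  b + b′ + dx + dy + 2 ≡ n + 2 * (c + a)
pair-arithmetic {n} {_} {c} {b′} {i} {a} {N} {dx} {dy} refl isolated-eq N-eq ie-eq = begin
  c + b′ + dx + dy + 2             ≡⟨ cong (c + b′ + dx + dy +_) (sym isolated-eq) ⟩
  c + b′ + dx + dy + (i + 2 * a)   ≡⟨ regroup c b′ dx dy i a ⟩
  (b′ + i) + dx + dy + (c + 2 * a) ≡⟨ cong (λ t → t + dx + dy + (c + 2 * a)) (sym N-eq) ⟩
  N + dx + dy + (c + 2 * a)        ≡⟨ cong (_+ (c + 2 * a)) ie-eq ⟩
  n + c + (c + 2 * a)              ≡⟨ collect n c a ⟩
  n + 2 * (c + a)                  ∎
  where
  open ≡-Reasoning
  regroup : ∀ c b′ dx dy i a → c + b′ + dx + dy + (i + 2 * a) ≡ (b′ + i) + dx + dy + (c + 2 * a)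
  regroup = solve-∀
  collect : ∀ n c a → n + c + (c + 2 * a) ≡ n + 2 * (c + a)
  collect = solve-∀

triple-arithmetic : ∀ {n b t b′ i N dx dy dz c₁ c₂ c₃ a₁ a₂ a₃ h} → b ≡ t →
  i + a₁ + a₂ + a₃ ≡ 2 + h → N ≡ b′ + i → t + N + dx + dy + dz ≡ n + c₁ + c₂ + c₃ →
  b + b′ + dx + dy + dz + 2 + h ≡ n + (c₁ + a₁) + (c₂ + a₂) + (c₃ + a₃)
triple-arithmetic {n} {_} {t} {b′} {i} {N} {dx} {dy} {dz} {c₁} {c₂} {c₃} {a₁} {a₂} {a₃} {h}
                  refl isolated-eq N-eq ie-eq = begin
  t + b′ + dx + dy + dz + 2 + h                     ≡⟨ +-assoc (t + b′ + dx + dy + dz) 2 h ⟩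
  t + b′ + dx + dy + dz + (2 + h)                   ≡⟨ cong (t + b′ + dx + dy + dz +_) (sym isolated-eq) ⟩
  t + b′ + dx + dy + dz + (i + a₁ + a₂ + a₃)        ≡⟨ regroup t b′ dx dy dz i a₁ a₂ a₃ ⟩
  t + (b′ + i) + dx + dy + dz + (a₁ + a₂ + a₃)      ≡⟨ cong (λ k → t + k + dx + dy + dz + _) (sym N-eq) ⟩
  t + N + dx + dy + dz + (a₁ + a₂ + a₃)             ≡⟨ cong (_+ (a₁ + a₂ + a₃)) ie-eq ⟩
  n + c₁ + c₂ + c₃ + (a₁ + a₂ + a₃)                 ≡⟨ collect n c₁ c₂ c₃ a₁ a₂ a₃ ⟩
  n + (c₁ + a₁) + (c₂ + a₂) + (c₃ + a₃)             ∎
  where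
  open ≡-Reasoning
  regroup : ∀ t b′ dx dy dz i a₁ a₂ a₃ →
    t + b′ + dx + dy + dz + (i + a₁ + a₂ + a₃) ≡ t + (b′ + i) + dx + dy + dz + (a₁ + a₂ + a₃)
  regroup = solve-∀
  collect : ∀ n c₁ c₂ c₃ a₁ a₂ a₃ →
    n + c₁ + c₂ + c₃ + (a₁ + a₂ + a₃) ≡ n + (c₁ + a₁) + (c₂ + a₂) + (c₃ + a₃)
  collect = solve-∀

module _ {n : ℕ} {G : Matrix n} (adjacency : IsAdjacency G) where

  private
    symmetric : ∀ i j → G i j ≡ G j i
    symmetric = proj₁ adjacency
    irreflexive : ∀ i → G i i ≡ false
    irreflexive = proj₂ adjacency

  isolated-pair : {x y : Fin n} → Unique (x ∷ y ∷ []) → isolated G (x ∷ y ∷ []) + 2 * ⟦ G x y ⟧ ≡ 2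
  isolated-pair {x} {y} unique
    rewrite count-∧-∈ᵇ (λ i → all (not ∘ G i) (x ∷ y ∷ [])) unique
          | irreflexive x | irreflexive y | symmetric y x
    with G x y
  ... | true = refl
  ... | false = refl

  isolated-triple : {x y z : Fin n} → Unique (x ∷ y ∷ z ∷ []) →
    isolated G (x ∷ y ∷ z ∷ []) + ⟦ G x y ⟧ + ⟦ G x z ⟧ + ⟦ G y z ⟧
    ≡ 2 + ⟦ homogeneous (G x y) (G x z) (G y z) ⟧
  isolated-triple {x} {y} {z} unique
    rewrite count-∧-∈ᵇ (λ i → all (not ∘ G i) (x ∷ y ∷ z ∷ [])) unique
          | irreflexive x | irreflexive y | irreflexive z
          | symmetric y x | symmetric z x | symmetric z y
    with G x y | G x z | G y z
  ... | true  | true  | true  = refl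
  ... | true  | true  | false = refl
  ... | true  | false | true  = refl
  ... | true  | false | false = refl
  ... | false | true  | true  = refl
  ... | false | true  | false = refl
  ... | false | false | true  = refl
  ... | false | false | false = refl

  covers-pair : {x y : Fin n} → Unique (x ∷ y ∷ []) →
    covers G (x ∷ y ∷ []) + covers (compl G) (x ∷ y ∷ []) + count (G x) + count (G y) + 2
    ≡ n + 2 * (count (λ v → G x v ∧ G y v) + ⟦ G x y ⟧)
  covers-pair {x} {y} unique =
    pair-arithmetic {dx = count (G x)} {dy = count (G y)}
      covers≡common (isolated-pair unique)
      (trans nonadjacent≡ (count-nonadjacent G (x ∷ y ∷ []))) (inclusion-exclusion₂ (G x) (G y))
    where
    covers≡common : covers G (x ∷ y ∷ []) ≡ count (λ v → G x v ∧ G y v)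
    covers≡common = count-cong (λ i → cong₂ _∧_ (symmetric i x) (trans (∧-identityʳ (G i y)) (symmetric i y)))
    nonadjacent≡ : count (λ i → not (G x i) ∧ not (G y i)) ≡ count (λ i → all (not ∘ G i) (x ∷ y ∷ []))
    nonadjacent≡ = count-cong (λ i → sym (cong₂ _∧_ (cong not (symmetric i x))
                                                    (trans (∧-identityʳ _) (cong not (symmetric i y)))))

  covers-triple : {x y z : Fin n} → Unique (x ∷ y ∷ z ∷ []) →
    covers G (x ∷ y ∷ z ∷ []) + covers (compl G) (x ∷ y ∷ z ∷ [])
      + count (G x) + count (G y) + count (G z) + 2 + ⟦ homogeneous (G x y) (G x z) (G y z) ⟧
    ≡ n + (count (λ v → G x v ∧ G y v) + ⟦ G x y ⟧) + (count (λ v → G x v ∧ G z v) + ⟦ G x z ⟧)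
        + (count (λ v → G y v ∧ G z v) + ⟦ G y z ⟧)
  covers-triple {x} {y} {z} unique =
    triple-arithmetic {dx = count (G x)} {dy = count (G y)} {dz = count (G z)}
                      {c₁ = count (λ v → G x v ∧ G y v)} {c₂ = count (λ v → G x v ∧ G z v)}
                      {c₃ = count (λ v → G y v ∧ G z v)}
      covers≡common (isolated-triple unique)
      (trans nonadjacent≡ (count-nonadjacent G (x ∷ y ∷ z ∷ []))) (inclusion-exclusion₃ (G x) (G y) (G z))
    where
    covers≡common : covers G (x ∷ y ∷ z ∷ []) ≡ count (λ v → G x v ∧ G y v ∧ G z v)
    covers≡common = count-cong (λ i → cong₂ _∧_ (symmetric i x)
                      (cong₂ _∧_ (symmetric i y) (trans (∧-identityʳ (G i z)) (symmetric i z))))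
    nonadjacent≡ : count (λ i → not (G x i) ∧ not (G y i) ∧ not (G z i))
                 ≡ count (λ i → all (not ∘ G i) (x ∷ y ∷ z ∷ []))
    nonadjacent≡ = count-cong (λ i → sym (cong₂ _∧_ (cong not (symmetric i x))
                      (cong₂ _∧_ (cong not (symmetric i y)) (trans (∧-identityʳ _) (cong not (symmetric i z))))))

  adjacent⇒≢ : {x y : Fin n} → G x y ≡ true → x ≢ y
  adjacent⇒≢ {x} x~y refl with trans (sym x~y) (irreflexive x)
  ... | ()

  degree+compl-degree : ∀ i → suc (count (G i) + count (compl G i)) ≡ n
  degree+compl-degree i = begin
    suc (count (G i) + count (compl G i))
      ≡⟨ sym (+-suc (count (G i)) _) ⟩
    count (G i) + suc (count (compl G i))
      ≡⟨ cong (count (G i) +_) (sym nonadjacent≡) ⟩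
    count (G i) + count (not ∘ G i)
      ≡⟨ sym (count-split (λ _ → true) (G i)) ⟩
    count {n} (λ _ → true)
      ≡⟨ count-true ⟩
    n ∎
    where
    open ≡-Reasoning
    nonadjacent≡ : count (not ∘ G i) ≡ suc (count (compl G i))
    nonadjacent≡ = trans (count-peel (not ∘ G i) i)
      (cong₂ _+_ (cong (⟦_⟧ ∘ not) (irreflexive i))
                 (count-cong (λ v → cong (λ b → not (G i v) ∧ not b) (does-⇔ (mk⇔ sym sym) (v ≟ i) (i ≟ v)))))

compl-degree-arithmetic : ∀ m {d} → suc (2 * m + d) ≡ 4 * m + 1 → d ≡ 2 * m
compl-degree-arithmetic m {d} eq = +-cancelˡ-≡ (2 * m) d (2 * m) (suc-injective (trans eq (split m)))
  where
  split : ∀ m → 4 * m + 1 ≡ suc (2 * m + 2 * m)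
  split = solve-∀

pair-value : ∀ m {B} → B + 2 * m + 2 * m + 2 ≡ 4 * m + 1 + 2 * m → B ≡ 2 * m ∸ 1
pair-value m {B} eq = trans (sym (m+n∸n≡m B 1)) (cong (_∸ 1) (+-cancelʳ-≡ (4 * m + 1) (B + 1) (2 * m)
  (trans (regroup B m) (trans eq (+-comm (4 * m + 1) (2 * m))))))
  where
  regroup : ∀ B m → B + 1 + (4 * m + 1) ≡ B + 2 * m + 2 * m + 2
  regroup = solve-∀

triple-value : ∀ m {B h} → B + 2 * m + 2 * m + 2 * m + 2 + h ≡ 4 * m + 1 + m + m + m → suc (h + B) ≡ m
triple-value m {B} {h} eq = +-cancelʳ-≡ (6 * m + 1) (suc (h + B)) m
  (trans (regroup B m h) (trans eq (collect m)))
  where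
  regroup : ∀ B m h → suc (h + B) + (6 * m + 1) ≡ B + 2 * m + 2 * m + 2 * m + 2 + h
  regroup = solve-∀
  collect : ∀ m → 4 * m + 1 + m + m + m ≡ m + (6 * m + 1)
  collect = solve-∀

module Paley {n m : ℕ} (n≡4m+1 : n ≡ 4 * m + 1) (1≤m : 1 ≤ m) {G : Matrix n}
  (srg : IsSRG G (2 * m) (m ∸ 1) m) where

  adjacency : IsAdjacency G
  adjacency = proj₁ srg

  degree : ∀ i → count (G i) ≡ 2 * m
  degree i = trans (sym (∣tabulate∣≡count (G i))) (proj₁ (proj₂ srg) i)

  common+adjacent : {x y : Fin n} → x ≢ y → count (λ v → G x v ∧ G y v) + ⟦ G x y ⟧ ≡ m
  common+adjacent {x} {y} x≢y with G x y in x~y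
  ... | true = trans (cong (_+ 1) (trans (sym (∣tabulate∣≡count (λ v → G x v ∧ G y v)))
                                         (proj₁ (proj₂ (proj₂ srg)) x y x≢y x~y)))
                     (m∸n+n≡m 1≤m)
  ... | false = trans (+-identityʳ _) (trans (sym (∣tabulate∣≡count (λ v → G x v ∧ G y v)))
                                             (proj₂ (proj₂ (proj₂ srg)) x y x≢y x~y))

  compl-degree : ∀ i → count (compl G i) ≡ 2 * m
  compl-degree i = compl-degree-arithmetic m (begin
    suc (2 * m + count (compl G i))       ≡⟨ cong (λ d → suc (d + count (compl G i))) (sym (degree i)) ⟩
    suc (count (G i) + count (compl G i)) ≡⟨ degree+compl-degree adjacency i ⟩
    n                                     ≡⟨ n≡4m+1 ⟩
    4 * m + 1                             ∎)
    where open ≡-Reasoning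

  pair-covers : {x y : Fin n} → Unique (x ∷ y ∷ []) →
    covers G (x ∷ y ∷ []) + covers (compl G) (x ∷ y ∷ []) ≡ 2 * m ∸ 1
  pair-covers {x} {y} unique@((x≢y ∷ []) ∷ _) = pair-value m (begin
    covers G (x ∷ y ∷ []) + covers (compl G) (x ∷ y ∷ []) + 2 * m + 2 * m + 2
      ≡⟨ cong₂ (λ d e → covers G (x ∷ y ∷ []) + covers (compl G) (x ∷ y ∷ []) + d + e + 2)
               (sym (degree x)) (sym (degree y)) ⟩
    covers G (x ∷ y ∷ []) + covers (compl G) (x ∷ y ∷ []) + count (G x) + count (G y) + 2
      ≡⟨ covers-pair adjacency unique ⟩
    n + 2 * (count (λ v → G x v ∧ G y v) + ⟦ G x y ⟧)
      ≡⟨ cong₂ (λ k c → k + 2 * c) n≡4m+1 (common+adjacent x≢y) ⟩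
    4 * m + 1 + 2 * m ∎)
    where open ≡-Reasoning

  triple-covers : {x y z : Fin n} → Unique (x ∷ y ∷ z ∷ []) →
    suc (⟦ homogeneous (G x y) (G x z) (G y z) ⟧
         + (covers G (x ∷ y ∷ z ∷ []) + covers (compl G) (x ∷ y ∷ z ∷ []))) ≡ m
  triple-covers {x} {y} {z} unique@((x≢y ∷ x≢z ∷ []) ∷ (y≢z ∷ []) ∷ _) = triple-value m {B} {h} (begin
    B + 2 * m + 2 * m + 2 * m + 2 + h
      ≡⟨ cong₃ (λ d e f → B + d + e + f + 2 + h) (sym (degree x)) (sym (degree y)) (sym (degree z)) ⟩
    B + count (G x) + count (G y) + count (G z) + 2 + h
      ≡⟨ covers-triple adjacency unique ⟩
    n + (c x y + ⟦ G x y ⟧) + (c x z + ⟦ G x z ⟧) + (c y z + ⟦ G y z ⟧)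
      ≡⟨ cong₃ (λ k d e → k + d + e + (c y z + ⟦ G y z ⟧))
               n≡4m+1 (common+adjacent x≢y) (common+adjacent x≢z) ⟩
    4 * m + 1 + m + m + (c y z + ⟦ G y z ⟧)
      ≡⟨ cong (4 * m + 1 + m + m +_) (common+adjacent y≢z) ⟩
    4 * m + 1 + m + m + m ∎)
    where
    open ≡-Reasoning
    B : ℕ
    B = covers G (x ∷ y ∷ z ∷ []) + covers (compl G) (x ∷ y ∷ z ∷ [])
    h : ℕ
    h = ⟦ homogeneous (G x y) (G x z) (G y z) ⟧
    c : Fin n → Fin n → ℕ
    c u v = count (λ w → G u w ∧ G v w)
    cong₃ : ∀ (f : ℕ → ℕ → ℕ → ℕ) {a a′ b b′ d d′} → a ≡ a′ → b ≡ b′ → d ≡ d′ → f a b d ≡ f a′ b′ d′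
    cong₃ f refl refl refl = refl

  0<2m : 0 < 2 * m
  0<2m = ≤-trans 1≤m (m≤m+n m (m + 0))

  vertex : Fin n
  vertex = subst Fin (sym (trans n≡4m+1 (+-comm (4 * m) 1))) zero

  neighbour : ∀ x → ∃ λ y → G x y ≡ true
  neighbour x = count>0 (G x) (subst (0 <_) (sym (degree x)) 0<2m)

  non-neighbour : ∀ x → ∃ λ w → compl G x w ≡ true
  non-neighbour x = count>0 (compl G x) (subst (0 <_) (sym (compl-degree x)) 0<2m)

  Triple : Bool → Set
  Triple b = ∃₂ λ x y → ∃ λ z → Unique (x ∷ y ∷ z ∷ []) × homogeneous (G x y) (G x z) (G y z) ≡ b

  triangle : 2 ≤ m → Triple true
  triangle 2≤m =
    let y , x~y = neighbour vertex
        z , x~z∧y~z = count>0 (λ v → G vertex v ∧ G y v) (common>0 x~y)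
        x~z , y~z = ∧≡true x~z∧y~z
    in vertex , y , z ,
       (adjacent⇒≢ adjacency x~y ∷ adjacent⇒≢ adjacency x~z ∷ [])
         ∷ (adjacent⇒≢ adjacency y~z ∷ []) ∷ [] ∷ [] ,
       homogeneous-true x~y x~z y~z
    where
    common>0 : ∀ {y} → G vertex y ≡ true → 0 < count (λ v → G vertex v ∧ G y v)
    common>0 {y} x~y = s≤s⁻¹ (subst (2 ≤_) (trans (sym common+1≡m) (+-comm _ 1)) 2≤m)
      where
      common+1≡m : count (λ v → G vertex v ∧ G y v) + 1 ≡ m
      common+1≡m = trans (cong (λ b → count (λ v → G vertex v ∧ G y v) + ⟦ b ⟧) (sym x~y))
                         (common+adjacent (adjacent⇒≢ adjacency x~y))

  inhomogeneous-triple : Triple false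
  inhomogeneous-triple =
    let y , x~y = neighbour vertex
        w , x≁w = non-neighbour vertex
        x-w , x≢w = compl≡true {G = G} x≁w
    in vertex , y , w ,
       (adjacent⇒≢ adjacency x~y ∷ x≢w ∷ []) ∷ (adjacent≢nonadjacent x~y x-w ∷ []) ∷ [] ∷ [] ,
       homogeneous-false x~y x-w
    where
    adjacent≢nonadjacent : ∀ {x y w} → G x y ≡ true → G x w ≡ false → y ≢ w
    adjacent≢nonadjacent x~y x-w refl with trans (sym x~y) x-w
    ... | ()

m∸2-or-suc : ∀ {m k} b → 2 ≤ m → suc (⟦ b ⟧ + k) ≡ m → k ≡ m ∸ 2 ⊎ k ≡ suc (m ∸ 2)
m∸2-or-suc true _ refl = inj₁ refl
m∸2-or-suc false (s≤s (s≤s _)) refl = inj₂ refl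

module PaleyDesign {n m : ℕ} (n≡4m+1 : n ≡ 4 * m + 1) (1≤m : 1 ≤ m) {A G : Matrix n}
  (srg : IsSRG G (2 * m) (m ∸ 1) m)
  (A-or-compl : ((∀ i j → A i j ≡ G i j) × (∀ i j → compl A i j ≡ compl G i j))
              ⊎ ((∀ i j → A i j ≡ compl G i j) × (∀ i j → compl A i j ≡ G i j))) where

  open Paley n≡4m+1 1≤m srg

  block-size : ∀ b → ∣ blocksAA' A b ∣ ≡ 2 * m
  block-size =
    [ (λ (A≗G , A′≗G′) → blocksAA'-size (row-size A≗G degree) (row-size A′≗G′ compl-degree))
    , (λ (A≗G′ , A′≗G) → blocksAA'-size (row-size A≗G′ compl-degree) (row-size A′≗G degree))
    ]′ A-or-compl

  countBlocks-enumerated : (S : Subset n) (xs : List (Fin n)) → (∀ v → lookup S v ≡ v ∈ᵇ xs) →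
    countBlocks (blocksAA' A) S ≡ covers G xs + covers (compl G) xs
  countBlocks-enumerated S xs S≗xs = trans (countBlocks-blocksAA' A S xs S≗xs)
    ([ (λ (A≗G , A′≗G′) → cong₂ _+_ (covers-cong A≗G xs) (covers-cong A′≗G′ xs))
     , (λ (A≗G′ , A′≗G) → trans (cong₂ _+_ (covers-cong A≗G′ xs) (covers-cong A′≗G xs))
                                 (+-comm (covers (compl G) xs) (covers G xs)))
     ]′ A-or-compl)

  2-design : IsDesign 2 (2 * m) (2 * m ∸ 1) (blocksAA' A)
  2-design = block-size , λ S ∣S∣≡2 → through-pair {S} (enumerate-subset 2 S ∣S∣≡2)
    where
    through-pair : ∀ {S} → (∃ λ xs → length xs ≡ 2 × Enumerates xs (lookup S)) →
      countBlocks (blocksAA' A) S ≡ 2 * m ∸ 1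
    through-pair {S} (xs@(_ ∷ _ ∷ []) , refl , unique , S≗xs) =
      trans (countBlocks-enumerated S xs S≗xs) (pair-covers unique)

  through-triple : (S : Subset n) {x y z : Fin n} → Enumerates (x ∷ y ∷ z ∷ []) (lookup S) →
    suc (⟦ homogeneous (G x y) (G x z) (G y z) ⟧ + countBlocks (blocksAA' A) S) ≡ m
  through-triple S {x} {y} {z} (unique , S≗xs) =
    trans (cong (λ k → suc (⟦ homogeneous (G x y) (G x z) (G y z) ⟧ + k))
                (countBlocks-enumerated S (x ∷ y ∷ z ∷ []) S≗xs))
          (triple-covers unique)

  3-adesign : 3 ≤ m → IsADesign 3 (2 * m) (m ∸ 2) (blocksAA' A)
  3-adesign 3≤m =
    block-size , ∸-monoˡ-≤ 2 3≤m , (λ S ∣S∣≡3 → two-values {S} (enumerate-subset 3 S ∣S∣≡3)) , not-design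
    where
    2≤m : 2 ≤ m
    2≤m = ≤-trans (n≤1+n 2) 3≤m
    two-values : ∀ {S} → (∃ λ xs → length xs ≡ 3 × Enumerates xs (lookup S)) →
      countBlocks (blocksAA' A) S ≡ m ∸ 2 ⊎ countBlocks (blocksAA' A) S ≡ suc (m ∸ 2)
    two-values {S} (_ ∷ _ ∷ _ ∷ [] , refl , enumerates) = m∸2-or-suc _ 2≤m (through-triple S enumerates)
    not-design : ¬ ∃ λ l → IsDesign 3 (2 * m) l (blocksAA' A)
    not-design (l , _ , constant) =
      1+n≢n (suc-injective (trans (at (triangle 2≤m)) (sym (at inhomogeneous-triple))))
      where
      at : ∀ {b} → Triple b → suc (⟦ b ⟧ + l) ≡ m
      at {b} (x , y , z , unique , h≡b) = trans
        (cong₂ (λ h k → suc (⟦ h ⟧ + k)) (sym h≡b) (sym (constant S ∣S∣≡3)))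
        (through-triple S (unique , lookup∘tabulate (_∈ᵇ (x ∷ y ∷ z ∷ []))))
        where
        S : Subset n
        S = tabulate (_∈ᵇ (x ∷ y ∷ z ∷ []))
        ∣S∣≡3 : ∣ S ∣ ≡ 3
        ∣S∣≡3 = trans (∣tabulate∣≡count (_∈ᵇ (x ∷ y ∷ z ∷ []))) (count-∧-∈ᵇ (λ _ → true) unique)

theorem1 : (n m : ℕ) → n ≡ 4 * m + 1 → 1 ≤ m → (A : Matrix n) → IsAdjacency A →
    (IsSRG A (2 * m) (m ∸ 1) m ⊎ IsSRG (compl A) (2 * m) (m ∸ 1) m) →
    IsDesign 2 (2 * m) (2 * m ∸ 1) (blocksAA' A)
    × (3 ≤ m → IsADesign 3 (2 * m) (m ∸ 2) (blocksAA' A))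
theorem1 n m n≡4m+1 1≤m A _ (inj₁ srg) = 2-design , 3-adesign
  where open PaleyDesign n≡4m+1 1≤m srg (inj₁ ((λ _ _ → refl) , (λ _ _ → refl)))
theorem1 n m n≡4m+1 1≤m A (_ , irreflexive) (inj₂ srg) = 2-design , 3-adesign
  where open PaleyDesign n≡4m+1 1≤m srg (inj₂ ((λ i j → sym (compl-involutive irreflexive i j)) , (λ _ _ → refl)))
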